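{- Let $k$ and $t$ be positive integers with $2\leq k\leq t$. Then $$B(KG(2t,k))=B(I_{2t}(k,k))=\binom{t}{k}^{2}.$$
   Context: A biclique of a graph $G$ is a complete bipartite subgraph of $G$. For a graph $G$, $B(G)$ denotes the maximum number of edges of a biclique of $G$. The Kneser graph $KG(n,r)$ has as vertices all $r$-subsets of an $n$-element set, two vertices adjacent iff the subsets are disjoint. The bi-intersection graph $I_n(r,w)$ is the bipartite graph whose vertices are all $w$-subsets and all $r$-subsets of an $n$-element set (as the two sides), where a $w$-subset is adjacent to an $r$-subset iff they are disjoint. -}

module Defs where

open import Data.Nat using (ℕ; _*_; _≤_)
open import Data.Fin using (Fin)
open import Data.Fin.Subset using (Subset; _∈_; ∣_∣)
open import Data.Product using (Σ; ∃; _×_; proj₁)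
open import Data.Sum using (_⊎_; inj₁; inj₂)
open import Data.Empty using (⊥)
open import Data.List using (List; length)
open import Data.List.Relation.Unary.All using (All)
open import Data.List.Relation.Unary.Unique.Propositional using (Unique)
import Data.List.Membership.Propositional as M
open import Relation.Binary.PropositionalEquality using (_≡_)
open import Relation.Nullary using (¬_)

record Graph : Set₁ where
  field
    V   : Set
    Adj : V → V → Set
open Graph public

Disjoint : ∀ {n} → Subset n → Subset n → Set
Disjoint {n} x y = (i : Fin n) → ¬ (i ∈ x × i ∈ y)

SubsetOfSize : ℕ → ℕ → Set
SubsetOfSize n r = Σ (Subset n) (λ s → ∣ s ∣ ≡ r)

KG : ℕ → ℕ → Graph
KG n r = record
  { V   = SubsetOfSize n r
  ; Adj = λ x y → Disjoint (proj₁ x) (proj₁ y) }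

BiAdj : ∀ {n r w} → SubsetOfSize n w ⊎ SubsetOfSize n r
                  → SubsetOfSize n w ⊎ SubsetOfSize n r → Set
BiAdj (inj₁ a) (inj₁ b) = ⊥
BiAdj (inj₁ a) (inj₂ b) = Disjoint (proj₁ a) (proj₁ b)
BiAdj (inj₂ a) (inj₁ b) = Disjoint (proj₁ a) (proj₁ b)
BiAdj (inj₂ a) (inj₂ b) = ⊥

I : ℕ → ℕ → ℕ → Graph
I n r w = record
  { V   = SubsetOfSize n w ⊎ SubsetOfSize n r
  ; Adj = BiAdj }

record Biclique (G : Graph) : Set where
  field
    A B      : List (V G)
    uniqueA  : Unique A
    uniqueB  : Unique B
    disjoint : All (λ a → ¬ (a M.∈ B)) A
    complete : All (λ a → All (λ b → Adj G a b) B) A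

edges : ∀ {G} → Biclique G → ℕ
edges β = length (Biclique.A β) * length (Biclique.B β)

IsMaxBiclique : Graph → ℕ → Set
IsMaxBiclique G m =
  (∃ λ (β : Biclique G) → edges β ≡ m) × ((β : Biclique G) → edges β ≤ m)

-- If every member of a family 𝒜 of k-subsets of [2t] is disjoint from every member of ℬ,
-- then 𝒜 consists of k-subsets of U = ⋃ 𝒜 and ℬ of k-subsets of its complement, so
-- |𝒜|·|ℬ| ≤ C(u,k)·C(2t-u,k) with u = |U|. By the absorption identity
-- (j+1)·C(n+1,j+1) = (n+1)·C(n,j), moving a point from the larger side to the smaller one
-- never decreases this product, so it is at most C(t,k)²; the k-subsets of one half of [2t]
-- against those of the other half attain the bound. Vertices of the same colour class of
-- I_{2t}(k,k) are never adjacent, so a biclique of it with both sides nonempty has each side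
-- inside one class, which reduces it to the Kneser case.

module Submission where

open import Defs
open import Data.Nat
open import Data.Nat.Properties
open import Data.Nat.Combinatorics using (_C_; nC1≡n; k>n⇒nCk≡0; nCk+nC[k+1]≡[n+1]C[k+1])
open import Data.Nat.Tactic.RingSolver using (solve-∀)
open import Data.Fin using (Fin)
open import Data.Fin.Subset
  using (Subset; inside; outside; _∈_; _⊆_; ∁; _∪_; ⋃; ∣_∣; ⊥)
open import Data.Fin.Subset.Properties
  using ( drop-∷-⊆; out⊆; in⊆in; ⊆-trans; p⊆p∪q; q⊆p∪q; x∈p∪q⁻; ∉⊥; ∣⊥∣≡0; Empty-unique
        ; x∈p⇒x∉∁p; x∉p⇒x∈∁p; ∣∁p∣≡n∸∣p∣; ∣p∣≤n)
open import Data.Vec using ([]; _∷_; here)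
open import Data.Vec.Properties using (∷-injectiveʳ)
open import Data.List using (List; []; _∷_; [_]; length; map; _++_)
open import Data.List.Properties using (length-map; length-++; length-removeAt′)
open import Data.List.Relation.Unary.All as All using (All; []; _∷_)
import Data.List.Relation.Unary.All.Properties as All
open import Data.List.Relation.Unary.Any using (Any; here; there; _─_)
open import Data.List.Relation.Unary.Unique.Propositional using (Unique; []; _∷_)
import Data.List.Relation.Unary.Unique.Propositional.Properties as Unique
import Data.List.Membership.Propositional as List
open import Data.List.Membership.Propositional.Properties using (∈-map⁺; ∈-map⁻; ∈-++⁺ˡ; ∈-++⁺ʳ)
open import Data.Product using (_×_; _,_; proj₁; proj₂)
open import Data.Sum using (_⊎_; inj₁; inj₂; [_,_]′)
open import Data.Sum.Properties using (inj₁-injective; inj₂-injective)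
open import Data.Empty using (⊥-elim)
open import Function using (_∘_)
open import Relation.Nullary using (¬_; contradiction)
open import Relation.Binary.PropositionalEquality
  using (_≡_; _≢_; refl; cong; cong₂; trans; sym; subst; subst₂; module ≡-Reasoning)

private variable
  n k : ℕ
  X Y : Set

∈-─⁺ : ∀ {x y : X} {ys} (x∈ys : x List.∈ ys) → x ≢ y → y List.∈ ys → y List.∈ (ys ─ x∈ys)
∈-─⁺ (here refl)  x≢y (here refl)  = ⊥-elim (x≢y refl)
∈-─⁺ (here refl)  _   (there y∈ys) = y∈ys
∈-─⁺ (there x∈ys) _   (here refl)  = here refl
∈-─⁺ (there x∈ys) x≢y (there y∈ys) = there (∈-─⁺ x∈ys x≢y y∈ys)

Unique-⊆⇒length≤ : ∀ {xs ys : List X} → Unique xs → (∀ {z} → z List.∈ xs → z List.∈ ys) →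
                   length xs ≤ length ys
Unique-⊆⇒length≤ {xs = []}     []           _     = z≤n
Unique-⊆⇒length≤ {xs = x ∷ xs} {ys} (x∉xs ∷ uxs) xs⊆ys =
  subst (suc (length xs) ≤_) (sym (length-removeAt′ ys _))
    (s≤s (Unique-⊆⇒length≤ uxs λ z∈xs → ∈-─⁺ x∈ys (All.lookup x∉xs z∈xs) (xs⊆ys (there z∈xs))))
  where x∈ys = xs⊆ys (here refl)

map-proj₁-toList : ∀ {P : X → Set} {xs} (ps : All P xs) → map proj₁ (All.toList ps) ≡ xs
map-proj₁-toList []       = refl
map-proj₁-toList (_ ∷ ps) = cong (_ ∷_) (map-proj₁-toList ps)

lefts : List (X ⊎ Y) → List X
lefts []           = []
lefts (inj₁ x ∷ xs) = x ∷ lefts xs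
lefts (inj₂ _ ∷ xs) = lefts xs

rights : List (X ⊎ Y) → List Y
rights []           = []
rights (inj₁ _ ∷ xs) = rights xs
rights (inj₂ y ∷ xs) = y ∷ rights xs

length-lefts+rights : ∀ (xs : List (X ⊎ Y)) → length xs ≡ length (lefts xs) + length (rights xs)
length-lefts+rights []            = refl
length-lefts+rights (inj₁ _ ∷ xs) = cong suc (length-lefts+rights xs)
length-lefts+rights (inj₂ _ ∷ xs) = trans (cong suc (length-lefts+rights xs)) (sym (+-suc _ _))

All-lefts : ∀ {P : X ⊎ Y → Set} {xs} → All P xs → All (P ∘ inj₁) (lefts xs)
All-lefts {xs = []}          []       = []
All-lefts {xs = inj₁ _ ∷ xs} (p ∷ ps) = p ∷ All-lefts ps
All-lefts {xs = inj₂ _ ∷ xs} (_ ∷ ps) = All-lefts ps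

All-rights : ∀ {P : X ⊎ Y → Set} {xs} → All P xs → All (P ∘ inj₂) (rights xs)
All-rights {xs = []}          []       = []
All-rights {xs = inj₁ _ ∷ xs} (_ ∷ ps) = All-rights ps
All-rights {xs = inj₂ _ ∷ xs} (p ∷ ps) = p ∷ All-rights ps

Unique-lefts : ∀ {xs : List (X ⊎ Y)} → Unique xs → Unique (lefts xs)
Unique-lefts {xs = []}          []         = []
Unique-lefts {xs = inj₁ _ ∷ xs} (x∉ ∷ uxs) = All.map (_∘ cong inj₁) (All-lefts x∉) ∷ Unique-lefts uxs
Unique-lefts {xs = inj₂ _ ∷ xs} (_  ∷ uxs) = Unique-lefts uxs

Unique-rights : ∀ {xs : List (X ⊎ Y)} → Unique xs → Unique (rights xs)
Unique-rights {xs = []}          []         = []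
Unique-rights {xs = inj₁ _ ∷ xs} (_  ∷ uxs) = Unique-rights uxs
Unique-rights {xs = inj₂ _ ∷ xs} (y∉ ∷ uxs) = All.map (_∘ cong inj₂) (All-rights y∉) ∷ Unique-rights uxs

All-All⇒length*length≡0 : ∀ {R : X → Y → Set} {xs ys} → (∀ {x y} → ¬ R x y) →
  All (λ x → All (R x) ys) xs → length xs * length ys ≡ 0
All-All⇒length*length≡0 {xs = []}     {ys}     _  _               = refl
All-All⇒length*length≡0 {xs = x ∷ xs} {[]}     _  _               = *-zeroʳ (length xs)
All-All⇒length*length≡0 {xs = x ∷ xs} {y ∷ ys} ¬R ((r ∷ _) ∷ _) = contradiction r ¬R

[a₁+a₂]*[b₁+b₂]≤m : ∀ a₁ b₁ a₂ b₂ {m} → a₁ * b₁ ≡ 0 → a₂ * b₂ ≡ 0 → a₁ * b₂ ≤ m → a₂ * b₁ ≤ m →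
                    (a₁ + a₂) * (b₁ + b₂) ≤ m
[a₁+a₂]*[b₁+b₂]≤m zero b₁ a₂ b₂ {m} _ a₂b₂≡0 _ a₂b₁≤m = begin
  a₂ * (b₁ + b₂)       ≡⟨ *-distribˡ-+ a₂ b₁ b₂ ⟩
  a₂ * b₁ + a₂ * b₂    ≡⟨ cong (a₂ * b₁ +_) a₂b₂≡0 ⟩
  a₂ * b₁ + 0          ≡⟨ +-identityʳ _ ⟩
  a₂ * b₁              ≤⟨ a₂b₁≤m ⟩
  m                    ∎
  where open ≤-Reasoning
[a₁+a₂]*[b₁+b₂]≤m a₁@(suc _) zero a₂ b₂ {m} _ a₂b₂≡0 a₁b₂≤m _ = begin
  (a₁ + a₂) * b₂       ≡⟨ *-distribʳ-+ b₂ a₁ a₂ ⟩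
  a₁ * b₂ + a₂ * b₂    ≡⟨ cong (a₁ * b₂ +_) a₂b₂≡0 ⟩
  a₁ * b₂ + 0          ≡⟨ +-identityʳ _ ⟩
  a₁ * b₂              ≤⟨ a₁b₂≤m ⟩
  m                    ∎
  where open ≤-Reasoning
[a₁+a₂]*[b₁+b₂]≤m (suc _) (suc _) _ _ () _ _ _

C-pascal : ∀ n k → suc n C suc k ≡ n C k + n C suc k
C-pascal n k = sym (nCk+nC[k+1]≡[n+1]C[k+1] n k)

C-absorption : ∀ n k → suc k * (suc n C suc k) ≡ suc n * (n C k)
C-absorption n       zero    = trans (*-identityˡ _) (trans (nC1≡n (suc n)) (sym (*-identityʳ (suc n))))
C-absorption zero    (suc k) = trans (cong (suc (suc k) *_) (k>n⇒nCk≡0 (s≤s (s≤s (z≤n {k}))))) (*-zeroʳ (suc (suc k)))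
C-absorption (suc n) (suc k) = begin
  suc (suc k) * (suc (suc n) C suc (suc k))
    ≡⟨ cong (suc (suc k) *_) (C-pascal (suc n) (suc k)) ⟩
  suc (suc k) * (suc n C suc k + suc n C suc (suc k))
    ≡⟨ split k (suc n C suc k) (suc n C suc (suc k)) ⟩
  suc k * (suc n C suc k) + suc n C suc k + suc (suc k) * (suc n C suc (suc k))
    ≡⟨ cong₂ (λ a b → a + suc n C suc k + b) (C-absorption n k) (C-absorption n (suc k)) ⟩
  suc n * (n C k) + suc n C suc k + suc n * (n C suc k)
    ≡⟨ merge n (n C k) (n C suc k) (suc n C suc k) ⟩
  suc n * (n C k + n C suc k) + suc n C suc k
    ≡⟨ cong (λ a → suc n * a + suc n C suc k) (C-pascal n k) ⟨
  suc n * (suc n C suc k) + suc n C suc k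
    ≡⟨ +-comm (suc n * (suc n C suc k)) _ ⟩
  suc (suc n) * (suc n C suc k) ∎
  where
  open ≡-Reasoning
  split : ∀ k x y → suc (suc k) * (x + y) ≡ suc k * x + x + suc (suc k) * y
  split = solve-∀
  merge : ∀ n x y z → suc n * x + z + suc n * y ≡ suc n * (x + y) + z
  merge = solve-∀

C-absorption′ : ∀ n k → suc k * (n C k + n C suc k) ≡ suc n * (n C k)
C-absorption′ n k = trans (cong (suc k *_) (sym (C-pascal n k))) (C-absorption n k)

-- C(a, j+1)/C(a, j) = (a-j)/(j+1) grows with a; cross-multiplied to stay in ℕ.
C-ratio-mono : ∀ j {a c} → a ≤ c → (a C suc j) * (c C j) ≤ (a C j) * (c C suc j)
C-ratio-mono j {a} {c} a≤c = +-cancelʳ-≤ (x₀ * y₀) _ _ (*-cancelˡ-≤ (suc j) (begin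
  suc j * (x₁ * y₀ + x₀ * y₀)   ≡⟨ gather j x₀ x₁ y₀ ⟩
  suc j * (x₀ + x₁) * y₀        ≡⟨ cong (_* y₀) (C-absorption′ a j) ⟩
  suc a * x₀ * y₀               ≤⟨ *-monoˡ-≤ y₀ (*-monoˡ-≤ x₀ (s≤s a≤c)) ⟩
  suc c * x₀ * y₀               ≡⟨ swap c x₀ y₀ ⟩
  x₀ * (suc c * y₀)             ≡⟨ cong (x₀ *_) (C-absorption′ c j) ⟨
  x₀ * (suc j * (y₀ + y₁))      ≡⟨ scatter j x₀ y₀ y₁ ⟩
  suc j * (x₀ * y₁ + x₀ * y₀)   ∎))
  where
  open ≤-Reasoning
  x₀ = a C j
  x₁ = a C suc j
  y₀ = c C j
  y₁ = c C suc j
  gather : ∀ j x y p → suc j * (y * p + x * p) ≡ suc j * (x + y) * p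
  gather = solve-∀
  swap : ∀ c x p → suc c * x * p ≡ x * (suc c * p)
  swap = solve-∀
  scatter : ∀ j x p q → x * (suc j * (p + q)) ≡ suc j * (x * q + x * p)
  scatter = solve-∀

C-*-shift : ∀ k {a c} → a ≤ c → (a C k) * (suc c C k) ≤ (suc a C k) * (c C k)
C-*-shift zero    _ = ≤-refl
C-*-shift (suc j) {a} {c} a≤c = begin
  (a C suc j) * (suc c C suc j)                       ≡⟨ cong ((a C suc j) *_) (C-pascal c j) ⟩
  (a C suc j) * (c C j + c C suc j)                   ≡⟨ *-distribˡ-+ (a C suc j) (c C j) _ ⟩
  (a C suc j) * (c C j) + (a C suc j) * (c C suc j)   ≤⟨ +-monoˡ-≤ _ (C-ratio-mono j a≤c) ⟩
  (a C j) * (c C suc j) + (a C suc j) * (c C suc j)   ≡⟨ *-distribʳ-+ (c C suc j) (a C j) _ ⟨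
  (a C j + a C suc j) * (c C suc j)                   ≡⟨ cong (_* (c C suc j)) (C-pascal a j) ⟨
  (suc a C suc j) * (c C suc j)                       ∎
  where open ≤-Reasoning

C-*-balance : ∀ k d u → (u C k) * ((d + (d + u)) C k) ≤ ((d + u) C k) * ((d + u) C k)
C-*-balance k zero    u = ≤-refl
C-*-balance k (suc d) u = begin
  (u C k) * ((suc d + (suc d + u)) C k)   ≤⟨ C-*-shift k (≤-trans (m≤n+m u (suc d)) (m≤n+m _ d)) ⟩
  (suc u C k) * ((d + suc (d + u)) C k)   ≡⟨ cong (λ m → (suc u C k) * ((d + m) C k)) (+-suc d u) ⟨
  (suc u C k) * ((d + (d + suc u)) C k)   ≤⟨ C-*-balance k d (suc u) ⟩
  ((d + suc u) C k) * ((d + suc u) C k)   ≡⟨ cong (λ m → (m C k) * (m C k)) (+-suc d u) ⟩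
  ((suc d + u) C k) * ((suc d + u) C k)   ∎
  where open ≤-Reasoning

C-*-≤-square : ∀ k {u v t} → u + v ≡ t + t → (u C k) * (v C k) ≤ (t C k) * (t C k)
C-*-≤-square k {u} {v} {t} u+v≡t+t = [ ordered u+v≡t+t , swapped ]′ (≤-total u v)
  where
  ordered : ∀ {u v} → u + v ≡ t + t → u ≤ v → (u C k) * (v C k) ≤ (t C k) * (t C k)
  ordered {u} {v} u+v≡t+t u≤v =
    subst₂ (λ v′ t′ → (u C k) * (v′ C k) ≤ (t′ C k) * (t′ C k)) d+[d+u]≡v d+u≡t (C-*-balance k d u)
    where
    open ≡-Reasoning
    u≤t : u ≤ t
    u≤t = ≮⇒≥ λ t<u → <-irrefl (sym u+v≡t+t) (<-≤-trans (+-mono-< t<u t<u) (+-monoʳ-≤ u u≤v))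
    d = t ∸ u
    d+u≡t : d + u ≡ t
    d+u≡t = m∸n+n≡m u≤t
    d+[d+u]≡v : d + (d + u) ≡ v
    d+[d+u]≡v = +-cancelˡ-≡ u _ _ (begin
      u + (d + (d + u))   ≡⟨ regroup u d ⟩
      (d + u) + (d + u)   ≡⟨ cong₂ _+_ d+u≡t d+u≡t ⟩
      t + t               ≡⟨ u+v≡t+t ⟨
      u + v               ∎)
      where
      regroup : ∀ u d → u + (d + (d + u)) ≡ (d + u) + (d + u)
      regroup = solve-∀
  swapped : v ≤ u → (u C k) * (v C k) ≤ (t C k) * (t C k)
  swapped v≤u =
    subst (_≤ (t C k) * (t C k)) (*-comm (v C k) (u C k)) (ordered (trans (+-comm v u) u+v≡t+t) v≤u)

⊆-⋃ : ∀ (ss : List (Subset n)) → All (_⊆ ⋃ ss) ss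
⊆-⋃ []       = []
⊆-⋃ (s ∷ ss) = p⊆p∪q (⋃ ss) ∷ All.map widen (⊆-⋃ ss)
  where
  widen : ∀ {t} → t ⊆ ⋃ ss → t ⊆ s ∪ ⋃ ss
  widen t⊆ = ⊆-trans t⊆ (q⊆p∪q s (⋃ ss))

∈-⋃⁻ : ∀ {x : Fin n} (ss : List (Subset n)) → x ∈ ⋃ ss → Any (x ∈_) ss
∈-⋃⁻ []       x∈⊥ = contradiction x∈⊥ ∉⊥
∈-⋃⁻ (s ∷ ss) x∈∪ with x∈p∪q⁻ s (⋃ ss) x∈∪
... | inj₁ x∈s = here x∈s
... | inj₂ x∈⋃ = there (∈-⋃⁻ ss x∈⋃)

∣p∣+∣∁p∣≡n : ∀ (p : Subset n) → ∣ p ∣ + ∣ ∁ p ∣ ≡ n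
∣p∣+∣∁p∣≡n p = trans (cong (∣ p ∣ +_) (∣∁p∣≡n∸∣p∣ p)) (m+[n∸m]≡n (∣p∣≤n p))

⊆∁⇒Disjoint : ∀ {a b U : Subset n} → a ⊆ U → b ⊆ ∁ U → Disjoint a b
⊆∁⇒Disjoint a⊆U b⊆∁U _ (x∈a , x∈b) = x∈p⇒x∉∁p (a⊆U x∈a) (b⊆∁U x∈b)

Disjoint⇒⊆∁⋃ : ∀ {b : Subset n} {as} → All (λ a → Disjoint a b) as → b ⊆ ∁ (⋃ as)
Disjoint⇒⊆∁⋃ {as = as} disj {x} x∈b = x∉p⇒x∈∁p λ x∈⋃ →
  All.lookupWith (λ a∩b≡∅ x∈a → a∩b≡∅ x (x∈a , x∈b)) disj (∈-⋃⁻ as x∈⋃)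

Disjoint-self⇒∣∣≡0 : ∀ {s : Subset n} → Disjoint s s → ∣ s ∣ ≡ 0
Disjoint-self⇒∣∣≡0 {n} d = trans (cong ∣_∣ (Empty-unique λ (x , x∈s) → d x (x∈s , x∈s))) (∣⊥∣≡0 n)

initialSegment : ∀ t {m} → Subset (t + m)
initialSegment zero    = ⊥
initialSegment (suc t) = inside ∷ initialSegment t

∣initialSegment∣ : ∀ t {m} → ∣ initialSegment t {m} ∣ ≡ t
∣initialSegment∣ zero    {m} = ∣⊥∣≡0 m
∣initialSegment∣ (suc t)     = cong suc (∣initialSegment∣ t)

∣∁initialSegment∣ : ∀ t {m} → ∣ ∁ (initialSegment t {m}) ∣ ≡ m
∣∁initialSegment∣ t {m} = begin
  ∣ ∁ (initialSegment t) ∣          ≡⟨ ∣∁p∣≡n∸∣p∣ (initialSegment t) ⟩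
  t + m ∸ ∣ initialSegment t ∣      ≡⟨ cong (t + m ∸_) (∣initialSegment∣ t) ⟩
  t + m ∸ t                         ≡⟨ m+n∸m≡n t m ⟩
  m                                 ∎
  where open ≡-Reasoning

subsetsOf : Subset n → ℕ → List (Subset n)
subsetsOf []            zero    = [ [] ]
subsetsOf []            (suc k) = []
subsetsOf (outside ∷ U) k       = map (outside ∷_) (subsetsOf U k)
subsetsOf (inside  ∷ U) zero    = map (outside ∷_) (subsetsOf U zero)
subsetsOf (inside  ∷ U) (suc k) =
  map (inside ∷_) (subsetsOf U k) ++ map (outside ∷_) (subsetsOf U (suc k))

length-subsetsOf : ∀ (U : Subset n) k → length (subsetsOf U k) ≡ ∣ U ∣ C k
length-subsetsOf []            zero    = refl
length-subsetsOf []            (suc k) = refl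
length-subsetsOf (outside ∷ U) k       =
  trans (length-map _ (subsetsOf U k)) (length-subsetsOf U k)
length-subsetsOf (inside  ∷ U) zero    =
  trans (length-map _ (subsetsOf U zero)) (length-subsetsOf U zero)
length-subsetsOf (inside  ∷ U) (suc k) = begin
  length (map (inside ∷_) (subsetsOf U k) ++ map (outside ∷_) (subsetsOf U (suc k)))
    ≡⟨ length-++ (map (inside ∷_) (subsetsOf U k)) ⟩
  length (map (inside ∷_) (subsetsOf U k)) + length (map (outside ∷_) (subsetsOf U (suc k)))
    ≡⟨ cong₂ _+_ (length-map _ (subsetsOf U k)) (length-map _ (subsetsOf U (suc k))) ⟩
  length (subsetsOf U k) + length (subsetsOf U (suc k))
    ≡⟨ cong₂ _+_ (length-subsetsOf U k) (length-subsetsOf U (suc k)) ⟩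
  ∣ U ∣ C k + ∣ U ∣ C suc k
    ≡⟨ nCk+nC[k+1]≡[n+1]C[k+1] ∣ U ∣ k ⟩
  suc ∣ U ∣ C suc k ∎
  where open ≡-Reasoning

subsetsOf-unique : ∀ (U : Subset n) k → Unique (subsetsOf U k)
subsetsOf-unique []            zero    = [] ∷ []
subsetsOf-unique []            (suc k) = []
subsetsOf-unique (outside ∷ U) k       = Unique.map⁺ ∷-injectiveʳ (subsetsOf-unique U k)
subsetsOf-unique (inside  ∷ U) zero    = Unique.map⁺ ∷-injectiveʳ (subsetsOf-unique U zero)
subsetsOf-unique (inside  ∷ U) (suc k) =
  Unique.++⁺ (Unique.map⁺ ∷-injectiveʳ (subsetsOf-unique U k))
             (Unique.map⁺ ∷-injectiveʳ (subsetsOf-unique U (suc k)))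
             heads-differ
  where
  heads-differ : ∀ {s} → ¬ (s List.∈ map (inside ∷_) (subsetsOf U k) × s List.∈ map (outside ∷_) (subsetsOf U (suc k)))
  heads-differ (p , q) with ∈-map⁻ _ p | ∈-map⁻ _ q
  ... | _ , _ , refl | _ , _ , ()

subsetsOf-size : ∀ (U : Subset n) k → All (λ s → ∣ s ∣ ≡ k) (subsetsOf U k)
subsetsOf-size []            zero    = refl ∷ []
subsetsOf-size []            (suc k) = []
subsetsOf-size (outside ∷ U) k       = All.map⁺ (subsetsOf-size U k)
subsetsOf-size (inside  ∷ U) zero    = All.map⁺ (subsetsOf-size U zero)
subsetsOf-size (inside  ∷ U) (suc k) =
  All.++⁺ (All.map⁺ (All.map (cong suc) (subsetsOf-size U k))) (All.map⁺ (subsetsOf-size U (suc k)))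

subsetsOf-⊆ : ∀ (U : Subset n) k → All (_⊆ U) (subsetsOf U k)
subsetsOf-⊆ []            zero    = (λ ()) ∷ []
subsetsOf-⊆ []            (suc k) = []
subsetsOf-⊆ (outside ∷ U) k       = All.map⁺ (All.map out⊆ (subsetsOf-⊆ U k))
subsetsOf-⊆ (inside  ∷ U) zero    = All.map⁺ (All.map out⊆ (subsetsOf-⊆ U zero))
subsetsOf-⊆ (inside  ∷ U) (suc k) =
  All.++⁺ (All.map⁺ (All.map in⊆in (subsetsOf-⊆ U k))) (All.map⁺ (All.map out⊆ (subsetsOf-⊆ U (suc k))))

∈-subsetsOf : ∀ {U s : Subset n} → ∣ s ∣ ≡ k → s ⊆ U → s List.∈ subsetsOf U k
∈-subsetsOf {k = zero}  {U = []}          {[]}          _  _   = here refl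
∈-subsetsOf             {U = outside ∷ U} {inside ∷ s}  _  s⊆U = contradiction (s⊆U here) λ ()
∈-subsetsOf             {U = outside ∷ U} {outside ∷ s} eq s⊆U =
  ∈-map⁺ _ (∈-subsetsOf eq (drop-∷-⊆ s⊆U))
∈-subsetsOf {k = zero}  {U = inside ∷ U}  {outside ∷ s} eq s⊆U =
  ∈-map⁺ _ (∈-subsetsOf eq (drop-∷-⊆ s⊆U))
∈-subsetsOf {k = suc k} {U = inside ∷ U}  {outside ∷ s} eq s⊆U =
  ∈-++⁺ʳ _ (∈-map⁺ _ (∈-subsetsOf eq (drop-∷-⊆ s⊆U)))
∈-subsetsOf {k = suc k} {U = inside ∷ U}  {inside ∷ s}  eq s⊆U =
  ∈-++⁺ˡ (∈-map⁺ _ (∈-subsetsOf (suc-injective eq) (drop-∷-⊆ s⊆U)))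

Unique-kSubsets⇒length≤C : ∀ {U : Subset n} {ss : List (Subset n)} → Unique ss →
  All (λ s → ∣ s ∣ ≡ k) ss → All (_⊆ U) ss → length ss ≤ ∣ U ∣ C k
Unique-kSubsets⇒length≤C {k = k} {U} {ss} uss sizes ⊆U = begin
  length ss              ≤⟨ Unique-⊆⇒length≤ uss (λ s∈ss →
                              ∈-subsetsOf (All.lookup sizes s∈ss) (All.lookup ⊆U s∈ss)) ⟩
  length (subsetsOf U k) ≡⟨ length-subsetsOf U k ⟩
  ∣ U ∣ C k              ∎
  where open ≤-Reasoning

proj₁-injective : ∀ {x y : SubsetOfSize n k} → proj₁ x ≡ proj₁ y → x ≡ y
proj₁-injective {x = s , p} {y = .s , q} refl = cong (s ,_) (≡-irrelevant p q)

kSubsetsOf : Subset n → (k : ℕ) → List (SubsetOfSize n k)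
kSubsetsOf U k = All.toList (subsetsOf-size U k)

proj₁-kSubsetsOf : ∀ (U : Subset n) k → map proj₁ (kSubsetsOf U k) ≡ subsetsOf U k
proj₁-kSubsetsOf U k = map-proj₁-toList (subsetsOf-size U k)

length-kSubsetsOf : ∀ (U : Subset n) k → length (kSubsetsOf U k) ≡ ∣ U ∣ C k
length-kSubsetsOf U k = begin
  length (kSubsetsOf U k)           ≡⟨ length-map proj₁ (kSubsetsOf U k) ⟨
  length (map proj₁ (kSubsetsOf U k)) ≡⟨ cong length (proj₁-kSubsetsOf U k) ⟩
  length (subsetsOf U k)            ≡⟨ length-subsetsOf U k ⟩
  ∣ U ∣ C k                         ∎
  where open ≡-Reasoning

kSubsetsOf-unique : ∀ (U : Subset n) k → Unique (kSubsetsOf U k)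
kSubsetsOf-unique U k = Unique.map⁻ (subst Unique (sym (proj₁-kSubsetsOf U k)) (subsetsOf-unique U k))

kSubsetsOf-⊆ : ∀ (U : Subset n) k → All (λ s → proj₁ s ⊆ U) (kSubsetsOf U k)
kSubsetsOf-⊆ U k = All.map⁻ (subst (All (_⊆ U)) (sym (proj₁-kSubsetsOf U k)) (subsetsOf-⊆ U k))

kSubsetsOf-crossDisjoint : ∀ (U : Subset n) k →
  All (λ a → All (λ b → Disjoint (proj₁ a) (proj₁ b)) (kSubsetsOf (∁ U) k)) (kSubsetsOf U k)
kSubsetsOf-crossDisjoint U k = All.map (λ {a} → disjointFromComplement {a}) (kSubsetsOf-⊆ U k)
  where
  disjointFromComplement : ∀ {a : SubsetOfSize _ k} → proj₁ a ⊆ U →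
    All (λ b → Disjoint (proj₁ a) (proj₁ b)) (kSubsetsOf (∁ U) k)
  disjointFromComplement a⊆U = All.map (⊆∁⇒Disjoint a⊆U) (kSubsetsOf-⊆ (∁ U) k)

crossDisjoint⇒length*length≤ : ∀ t {as bs : List (Subset (2 * t))} → Unique as → Unique bs →
  All (λ s → ∣ s ∣ ≡ k) as → All (λ s → ∣ s ∣ ≡ k) bs → All (λ a → All (Disjoint a) bs) as →
  length as * length bs ≤ (t C k) * (t C k)
crossDisjoint⇒length*length≤ {k = k} t {as} {bs} uas ubs sizesA sizesB cross =
  ≤-trans (*-mono-≤ as≤ bs≤) (C-*-≤-square k (trans (∣p∣+∣∁p∣≡n U) 2*t≡t+t))
  where
  U = ⋃ as
  as≤ : length as ≤ ∣ U ∣ C k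
  as≤ = Unique-kSubsets⇒length≤C uas sizesA (⊆-⋃ as)
  bs≤ : length bs ≤ ∣ ∁ U ∣ C k
  bs≤ = Unique-kSubsets⇒length≤C ubs sizesB
          (All.tabulate λ b∈bs → Disjoint⇒⊆∁⋃ (All.map (λ a→bs → All.lookup a→bs b∈bs) cross))
  2*t≡t+t : 2 * t ≡ t + t
  2*t≡t+t = cong (t +_) (+-identityʳ t)

KG-crossDisjoint⇒length*length≤ : ∀ t {as bs : List (SubsetOfSize (2 * t) k)} →
  Unique as → Unique bs → All (λ a → All (λ b → Disjoint (proj₁ a) (proj₁ b)) bs) as →
  length as * length bs ≤ (t C k) * (t C k)
KG-crossDisjoint⇒length*length≤ t {as} {bs} uas ubs cross =
  subst₂ (λ p q → p * q ≤ _) (length-map proj₁ as) (length-map proj₁ bs)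
    (crossDisjoint⇒length*length≤ t (Unique.map⁺ proj₁-injective uas) (Unique.map⁺ proj₁-injective ubs)
      (All.map⁺ (All.universal proj₂ as)) (All.map⁺ (All.universal proj₂ bs))
      (All.map⁺ (All.map All.map⁺ cross)))

looplessBiclique : ∀ {G} → (∀ v → ¬ Adj G v v) → {as bs : List (V G)} →
  Unique as → Unique bs → All (λ a → All (Adj G a) bs) as → Biclique G
looplessBiclique loopless {as} {bs} uas ubs complete = record
  { A        = as
  ; B        = bs
  ; uniqueA  = uas
  ; uniqueB  = ubs
  ; disjoint = All.map (λ a→bs a∈bs → loopless _ (All.lookup a→bs a∈bs)) complete
  ; complete = complete
  }

KG-loopless : ∀ (v : V (KG n (suc k))) → ¬ Adj (KG n (suc k)) v v
KG-loopless (s , ∣s∣≡1+k) d = 0≢1+n (trans (sym (Disjoint-self⇒∣∣≡0 d)) ∣s∣≡1+k)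

I-loopless : ∀ {r w} (v : V (I n r w)) → ¬ Adj (I n r w) v v
I-loopless (inj₁ _) ()
I-loopless (inj₂ _) ()

KG-biclique : Subset n → Biclique (KG n (suc k))
KG-biclique {k = k} U = looplessBiclique KG-loopless
  (kSubsetsOf-unique U (suc k)) (kSubsetsOf-unique (∁ U) (suc k)) (kSubsetsOf-crossDisjoint U (suc k))

edges-KG-biclique : ∀ (U : Subset n) → edges (KG-biclique {k = k} U) ≡ (∣ U ∣ C suc k) * (∣ ∁ U ∣ C suc k)
edges-KG-biclique {k = k} U = cong₂ _*_ (length-kSubsetsOf U (suc k)) (length-kSubsetsOf (∁ U) (suc k))

I-biclique : Subset n → Biclique (I n k k)
I-biclique {k = k} U = looplessBiclique I-loopless
  (Unique.map⁺ inj₁-injective (kSubsetsOf-unique U k))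
  (Unique.map⁺ inj₂-injective (kSubsetsOf-unique (∁ U) k))
  (All.map⁺ (All.map All.map⁺ (kSubsetsOf-crossDisjoint U k)))

edges-I-biclique : ∀ (U : Subset n) → edges (I-biclique {k = k} U) ≡ (∣ U ∣ C k) * (∣ ∁ U ∣ C k)
edges-I-biclique {k = k} U = cong₂ _*_
  (trans (length-map inj₁ (kSubsetsOf U k)) (length-kSubsetsOf U k))
  (trans (length-map inj₂ (kSubsetsOf (∁ U) k)) (length-kSubsetsOf (∁ U) k))

KG-edges≤ : ∀ t (β : Biclique (KG (2 * t) k)) → edges β ≤ (t C k) * (t C k)
KG-edges≤ t β = KG-crossDisjoint⇒length*length≤ t uniqueA uniqueB complete
  where open Biclique β

I-edges≤ : ∀ t (β : Biclique (I (2 * t) k k)) → edges β ≤ (t C k) * (t C k)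
I-edges≤ {k = k} t β =
  subst (_≤ (t C k) * (t C k)) (sym (cong₂ _*_ (length-lefts+rights A) (length-lefts+rights B)))
    ([a₁+a₂]*[b₁+b₂]≤m (length (lefts A)) (length (lefts B)) (length (rights A)) (length (rights B))
      (All-All⇒length*length≡0 (λ ()) (All-lefts (All.map All-lefts complete)))
      (All-All⇒length*length≡0 (λ ()) (All-rights (All.map All-rights complete)))
      (KG-crossDisjoint⇒length*length≤ t (Unique-lefts uniqueA) (Unique-rights uniqueB)
        (All-lefts (All.map All-rights complete)))
      (KG-crossDisjoint⇒length*length≤ t (Unique-rights uniqueA) (Unique-lefts uniqueB)
        (All-rights (All.map All-lefts complete))))
  where open Biclique β

lemma2p1 : (k t : ℕ) → 2 ≤ k → k ≤ t →
    IsMaxBiclique (KG (2 * t) k) ((t C k) * (t C k)) ×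
    IsMaxBiclique (I (2 * t) k k) ((t C k) * (t C k))
lemma2p1 (suc k) t _ _ =
    ((KG-biclique H , balanced (edges-KG-biclique H)) , KG-edges≤ t)
  , ((I-biclique H , balanced (edges-I-biclique H)) , I-edges≤ t)
  where
  H : Subset (2 * t)
  H = initialSegment t
  balanced : ∀ {e} → e ≡ (∣ H ∣ C suc k) * (∣ ∁ H ∣ C suc k) → e ≡ (t C suc k) * (t C suc k)
  balanced e≡ = trans e≡ (cong₂ (λ p q → (p C suc k) * (q C suc k))
    (∣initialSegment∣ t) (trans (∣∁initialSegment∣ t) (+-identityʳ t)))
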